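{- Let $q\geq 3$ be an integer, let $k\geq 2$, $n\geq k+2$ be integers and $0\leq e\leq q-2$ an integer. Let $u$ be the integer whose base-$q$ representation consists of $k$ digits equal to $q-1$, followed by one digit $0$, followed by $n$ digits equal to $q-1$, followed by the final (units) digit $e$; that is, $u=e+(q^n-1)q+(q^k-1)q^{n+2}$. Then $$s_q(u)=(q-1)(n+k)+e$$ and $$s_q(u^2)=(q-1)(n+1)+f(q,e),$$ where $$f(q,e)=s_q\big((q-e)^2\big)+s_q\big(2(q-1)(q-e)\big)-s_q\big(2(q-e)-1\big).$$
   Context: For an integer $q\geq 2$ and a nonnegative integer $m$, $s_q(m)$ denotes the sum of the digits of $m$ in its base-$q$ expansion. -}

module Defs where

open import Data.Nat using (ℕ; zero; suc; _+_; _*_; _∸_; _^_)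
open import Data.Nat.DivMod using (_/_; _%_)

-- Sum of base-(b+2) digits, with fuel (fuel ≥ m suffices, since m / base < m for m > 0).
digitSumAux : (b fuel m : ℕ) → ℕ
digitSumAux b zero    m = 0
digitSumAux b (suc f) zero = 0
digitSumAux b (suc f) m@(suc _) = m % suc (suc b) + digitSumAux b f (m / suc (suc b))

-- s_q(m): sum of the digits of m in base q (meaningful for q ≥ 2;
-- for q < 2 it is set to 0 by convention, never used).
s : (q m : ℕ) → ℕ
s zero m = 0
s (suc zero) m = 0
s (suc (suc b)) m = digitSumAux b m m

-- f(q,e) + s_q(2(q-e)-1) = s_q((q-e)^2) + s_q(2(q-1)(q-e)).
-- f can be an integer a priori, so we only name the two nonnegative parts and
-- state the identity with s_q(2(q-e)-1) moved to the other side.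
fPlus : (q e : ℕ) → ℕ
fPlus q e = s q ((q ∸ e) * (q ∸ e)) + s q (2 * (q ∸ 1) * (q ∸ e))

fMinus : (q e : ℕ) → ℕ
fMinus q e = s q (2 * (q ∸ e) ∸ 1)

module Submission where

open import Data.Nat
open import Data.Nat.Properties
open import Data.Nat.DivMod
open import Data.Nat.Divisibility using (m∣m*n)
open import Data.Product using (_×_; _,_)
open import Relation.Binary.PropositionalEquality
open import Data.Nat.Tactic.RingSolver
open import Algebra.Properties.CommutativeSemigroup +-commutativeSemigroup using (interchange)
open import Defs

-- In base q every identity below is a statement about
-- concatenating blocks of digits, so the digit sum s_q is additive over them:
--   * s_q(a + q^j m) = s_q(a) + s_q(m) whenever a < q^j (no carries), and
--   * s_q(c) + s_q(c') = j(q-1) whenever c + c' + 1 = q^j (complementary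
--     blocks); in particular s_q(q^j - 1) = j(q-1).
-- With d = q - e we have u + d = q^{n+1}(1 + (q^k - 1)q), and expanding
-- (u + d)^2 shows that, writing n = k + 2 + o, the square u^2 is the
-- concatenation (from the units digit up) of the blocks
--   d^2 | 2(q-1)d | q^{o+2} - 2d | 0 | q - 2 | 2 | q^k - 2
-- of lengths n+1, k+1, o+2, 1, k, 1, k.

u : (q k n e : ℕ) → ℕ
u q k n e = e + (q ^ n ∸ 1) * q + (q ^ k ∸ 1) * q ^ (n + 2)

u-unfold : ∀ q k n e → u q k n e ≡ e + (q ^ n ∸ 1) * q + (q ^ k ∸ 1) * (q ^ n * (q * (q * 1)))
u-unfold q k n e = cong (λ p → e + (q ^ n ∸ 1) * q + (q ^ k ∸ 1) * p) (^-distribˡ-+-* q n 2)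

-- Regrouping u as the digit e followed by the number N + Q·(q·K)
-- (blocks N = q^n - 1 and K = q^k - 1 separated by one zero digit).
u-digit-blocks : ∀ q e N K Q →
  e + N * q + K * (Q * (q * (q * 1))) ≡ e + q * (N + Q * (q * K))
u-digit-blocks = solve-∀

u-plus-complement-identity : ∀ q e d N K Q → e + d ≡ q → N + 1 ≡ Q →
  e + N * q + K * (Q * (q * (q * 1))) + d ≡ q * Q * (1 + K * q)
u-plus-complement-identity _ e d N K _ refl refl = identity e d N K
  where
  identity : ∀ e d N K →
    e + N * (e + d) + K * ((N + 1) * ((e + d) * ((e + d) * 1))) + d
      ≡ (e + d) * (N + 1) * (1 + K * (e + d))
  identity = solve-∀

-- The expansion of X² = (u + d)² producing the digit blocks of u²: with
-- K = q^k = 2 + K₂, M = q^(o+2) = 2d + W and G = q^(n+1) = qKM,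
-- X² + d² = d² + G(2(q-1)d + qK(W + M·q·(q-2 + K(2 + qK₂)))) + 2dX.
square-identity : ∀ b d K₂ W K M G → 2 + K₂ ≡ K → 2 * d + W ≡ M → (2 + b) * K * M ≡ G →
  let q = 2 + b ; X = G * (1 + (K ∸ 1) * q) in
  X * X + d * d
    ≡ d * d + G * (2 * suc b * d + q * K * (W + M * (q * (b + K * (2 + q * K₂))))) + 2 * d * X
square-identity b d K₂ W _ _ _ refl refl refl = identity b d K₂ W
  where
  identity : ∀ b d K₂ W →
    let q = 2 + b ; K = 2 + K₂ ; M = 2 * d + W ; X = q * K * M * (1 + suc K₂ * q) in
    X * X + d * d
      ≡ d * d + q * K * M * (2 * suc b * d + q * K * (W + M * (q * (b + K * (2 + q * K₂))))) + 2 * d * X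
  identity = solve-∀

square-from-sum : ∀ u d X R → u + d ≡ X → X * X + d * d ≡ R + 2 * d * X → u * u ≡ R
square-from-sum u d X R refl expansion =
  +-cancelʳ-≡ (2 * d * (u + d)) (u * u) R (trans (square-sum u d) expansion)
  where
  square-sum : ∀ u d → u * u + 2 * d * (u + d) ≡ (u + d) * (u + d) + d * d
  square-sum = solve-∀

complement-boundˡ : ∀ {c c' n} → suc c + c' ≡ n → c < n
complement-boundˡ {c} {c'} eq = subst (c <_) eq (s≤s (m≤m+n c c'))

complement-boundʳ : ∀ {c c' n} → suc c + c' ≡ n → c' < n
complement-boundʳ {c} {c'} eq = subst (c' <_) eq (m<n+m c' (s≤s z≤n))

complement-identity : ∀ {q P} c₀ c₁ w w₁ → suc c₀ + w ≡ q → suc c₁ + w₁ ≡ P →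
  suc (c₀ + q * c₁) + (w + q * w₁) ≡ q * P
complement-identity c₀ c₁ w w₁ refl refl = identity c₀ c₁ w w₁
  where
  identity : ∀ c₀ c₁ w w₁ →
    suc (c₀ + suc (c₀ + w) * c₁) + (w + suc (c₀ + w) * w₁) ≡ suc (c₀ + w) * suc (c₁ + w₁)
  identity = solve-∀

-- The final count of digits of u²: with s_q(c) + s_q(W) = (o+2)(q-1) and
-- 1 + s_q(K₂) = k(q-1), the blocks above 2(q-1)d contribute (n+1)(q-1) - s_q(c).
digit-count : ∀ b k o x y w t c → c + w ≡ (2 + o) * suc b → 1 + t ≡ k * suc b →
  x + (y + (w + (b + (2 + t)))) + c ≡ suc b * (k + 2 + o + 1) + (x + y)
digit-count b k o x y w t c c+w 1+t = begin
  x + (y + (w + (b + (2 + t)))) + c                 ≡⟨ regroup x y w b t c ⟩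
  x + y + (c + w) + (1 + t) + suc b                 ≡⟨ cong₂ (λ p r → x + y + p + r + suc b) c+w 1+t ⟩
  x + y + (2 + o) * suc b + k * suc b + suc b       ≡⟨ collect x y b k o ⟩
  suc b * (k + 2 + o + 1) + (x + y)                 ∎
  where
  open ≡-Reasoning
  regroup : ∀ x y w b t c → x + (y + (w + (b + (2 + t)))) + c ≡ x + y + (c + w) + (1 + t) + suc b
  regroup = solve-∀
  collect : ∀ x y b k o → x + y + (2 + o) * suc b + k * suc b + suc b ≡ suc b * (k + 2 + o + 1) + (x + y)
  collect = solve-∀

module Digits (b : ℕ) where

  q : ℕ
  q = suc (suc b)

  quotient-shrinks : ∀ m → suc m / q ≤ m
  quotient-shrinks m = s≤s⁻¹ (m/n<m (suc m) q (s≤s (s≤s z≤n)))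

  fuel-irrelevant : ∀ f g m → m ≤ f → m ≤ g → digitSumAux b f m ≡ digitSumAux b g m
  fuel-irrelevant zero    zero    zero    _         _         = refl
  fuel-irrelevant zero    (suc g) zero    _         _         = refl
  fuel-irrelevant (suc f) zero    zero    _         _         = refl
  fuel-irrelevant (suc f) (suc g) zero    _         _         = refl
  fuel-irrelevant (suc f) (suc g) (suc m) (s≤s m≤f) (s≤s m≤g) =
    cong (suc m % q +_) (fuel-irrelevant f g (suc m / q)
      (≤-trans (quotient-shrinks m) m≤f) (≤-trans (quotient-shrinks m) m≤g))

  euclid : ∀ x → x ≡ x % q + q * (x / q)
  euclid x = trans (m≡m%n+[m/n]*n x q) (cong (x % q +_) (*-comm (x / q) q))

  quotient-bound : ∀ j x → x < q ^ suc j → x / q < q ^ j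
  quotient-bound j x lt = m<n*o⇒m/o<n (subst (x <_) (*-comm q (q ^ j)) lt)

  last-digit : ∀ a m → a < q → (a + q * m) % q ≡ a
  last-digit a m a<q = begin
    (a + q * m) % q  ≡⟨ cong (λ x → (a + x) % q) (*-comm q m) ⟩
    (a + m * q) % q  ≡⟨ [m+kn]%n≡m%n a m q ⟩
    a % q            ≡⟨ m<n⇒m%n≡m a<q ⟩
    a                ∎
    where open ≡-Reasoning

  drop-digit : ∀ a m → a < q → (a + q * m) / q ≡ m
  drop-digit a m a<q = begin
    (a + q * m) / q      ≡⟨ +-distrib-/-∣ʳ a (m∣m*n m) ⟩
    a / q + q * m / q    ≡⟨ cong₂ _+_ (m<n⇒m/n≡0 a<q) (cong (_/ q) (*-comm q m)) ⟩
    m * q / q            ≡⟨ m*n/n≡m m q ⟩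
    m                    ∎
    where open ≡-Reasoning

  s-digit : ∀ a m → a < q → s q (a + q * m) ≡ a + s q m
  s-digit a m a<q with a + q * m in eq
  ... | zero with m+n≡0⇒m≡0 a eq | m+n≡0⇒m≡0 m (m+n≡0⇒n≡0 a eq)
  ...   | refl | refl = refl
  s-digit a m a<q | suc x = cong₂ _+_ remainder quotient
    where
    remainder : suc x % q ≡ a
    remainder = trans (cong (_% q) (sym eq)) (last-digit a m a<q)
    quotient-is-m : suc x / q ≡ m
    quotient-is-m = trans (cong (_/ q) (sym eq)) (drop-digit a m a<q)
    quotient : digitSumAux b x (suc x / q) ≡ s q m
    quotient rewrite quotient-is-m =
      fuel-irrelevant x m m (subst (_≤ x) quotient-is-m (quotient-shrinks x)) ≤-refl

  s-shift : ∀ m → s q (q * m) ≡ s q m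
  s-shift m = s-digit 0 m (s≤s z≤n)

  s-small : ∀ a → a < q → s q a ≡ a
  s-small a a<q = begin
    s q a            ≡⟨ cong (s q) (sym (trans (cong (a +_) (*-zeroʳ q)) (+-identityʳ a))) ⟩
    s q (a + q * 0)  ≡⟨ s-digit a 0 a<q ⟩
    a + 0            ≡⟨ +-identityʳ a ⟩
    a                ∎
    where open ≡-Reasoning

  s-concat : ∀ j a m → a < q ^ j → s q (a + q ^ j * m) ≡ s q a + s q m
  s-concat zero    zero    m _         = cong (s q) (+-identityʳ m)
  s-concat zero    (suc a) m (s≤s ())
  s-concat (suc j) a       m a<q^[1+j] = begin
    s q (a + q ^ suc j * m)            ≡⟨ cong (λ x → s q (x + q ^ suc j * m)) (euclid a) ⟩
    s q (a₀ + q * a₁ + q * q ^ j * m)  ≡⟨ cong (s q) (regroup a₀ a₁ q (q ^ j) m) ⟩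
    s q (a₀ + q * (a₁ + q ^ j * m))    ≡⟨ s-digit a₀ (a₁ + q ^ j * m) a₀<q ⟩
    a₀ + s q (a₁ + q ^ j * m)          ≡⟨ cong (a₀ +_) (s-concat j a₁ m (quotient-bound j a a<q^[1+j])) ⟩
    a₀ + (s q a₁ + s q m)              ≡⟨ sym (+-assoc a₀ _ _) ⟩
    a₀ + s q a₁ + s q m                ≡⟨ cong (_+ s q m) (sym (s-digit a₀ a₁ a₀<q)) ⟩
    s q (a₀ + q * a₁) + s q m          ≡⟨ cong (λ x → s q x + s q m) (sym (euclid a)) ⟩
    s q a + s q m                      ∎
    where
    open ≡-Reasoning
    a₀ = a % q
    a₁ = a / q
    a₀<q : a₀ < q
    a₀<q = m%n<n a q
    regroup : ∀ a₀ a₁ q p m → a₀ + q * a₁ + q * p * m ≡ a₀ + q * (a₁ + p * m)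
    regroup = solve-∀

  -- Complementary blocks: if c + c' + 1 = q^j then, digit by digit, the
  -- digits of c and c' add up to q - 1.
  s-complement : ∀ j c c' → suc c + c' ≡ q ^ j → s q c + s q c' ≡ j * suc b
  s-complement zero    zero    zero     refl = refl
  s-complement (suc j) c       c'       eq
    with m≤n⇒∃[o]m+o≡n (m%n<n c q)
       | m≤n⇒∃[o]m+o≡n (quotient-bound j c (complement-boundˡ eq))
  ... | w , c₀+w | w₁ , c₁+w₁ = begin
    s q c + s q c'                        ≡⟨ cong₂ _+_ (cong (s q) (euclid c)) (cong (s q) c'-digits) ⟩
    s q (c₀ + q * c₁) + s q (w + q * w₁)  ≡⟨ cong₂ _+_ (s-digit c₀ c₁ (m%n<n c q)) (s-digit w w₁ (complement-boundʳ c₀+w)) ⟩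
    (c₀ + s q c₁) + (w + s q w₁)          ≡⟨ interchange c₀ (s q c₁) w (s q w₁) ⟩
    (c₀ + w) + (s q c₁ + s q w₁)          ≡⟨ cong₂ _+_ (suc-injective c₀+w) (s-complement j c₁ w₁ c₁+w₁) ⟩
    suc b + j * suc b                     ∎
    where
    open ≡-Reasoning
    c₀ = c % q
    c₁ = c / q
    c'-digits : c' ≡ w + q * w₁
    c'-digits = +-cancelˡ-≡ (suc c) c' (w + q * w₁) (trans eq (sym (begin
      suc c + (w + q * w₁)                 ≡⟨ cong (λ x → suc x + (w + q * w₁)) (euclid c) ⟩
      suc (c₀ + q * c₁) + (w + q * w₁)     ≡⟨ complement-identity c₀ c₁ w w₁ c₀+w c₁+w₁ ⟩
      q * q ^ j                            ∎)))

  s-nines : ∀ j → s q (q ^ j ∸ 1) ≡ j * suc b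
  s-nines j = s-complement j 0 (q ^ j ∸ 1) (m+[n∸m]≡n (m^n>0 q j))

  2q≤q² : 2 * q ≤ q * q
  2q≤q² = *-monoˡ-≤ q {2} {q} (s≤s (s≤s z≤n))

  pow-square : ∀ j → 2 ≤ j → q * q ≤ q ^ j
  pow-square j 2≤j = subst (_≤ q ^ j) (cong (q *_) (*-identityʳ q)) (^-monoʳ-≤ q 2≤j)

  s-u : ∀ k n e → e < q → s q (u q k n e) ≡ (q ∸ 1) * (n + k) + e
  s-u k n e e<q = begin
    s q (u q k n e)                      ≡⟨ cong (s q) (trans (u-unfold q k n e) (u-digit-blocks q e N K (q ^ n))) ⟩
    s q (e + q * (N + q ^ n * (q * K)))  ≡⟨ s-digit e (N + q ^ n * (q * K)) e<q ⟩
    e + s q (N + q ^ n * (q * K))        ≡⟨ cong (e +_) (s-concat n N (q * K) (complement-boundʳ 1+N)) ⟩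
    e + (s q N + s q (q * K))            ≡⟨ cong (λ x → e + (s q N + x)) (s-shift K) ⟩
    e + (s q N + s q K)                  ≡⟨ cong₂ (λ x y → e + (x + y)) (s-nines n) (s-nines k) ⟩
    e + (n * suc b + k * suc b)          ≡⟨ collect e n k (suc b) ⟩
    suc b * (n + k) + e                  ∎
    where
    open ≡-Reasoning
    N = q ^ n ∸ 1
    K = q ^ k ∸ 1
    1+N : suc 0 + N ≡ q ^ n
    1+N = m+[n∸m]≡n (m^n>0 q n)
    collect : ∀ e n k c → e + (n * c + k * c) ≡ c * (n + k) + e
    collect = solve-∀

  u-plus-complement : ∀ k n e → e ≤ q → u q k n e + (q ∸ e) ≡ q ^ suc n * (1 + (q ^ k ∸ 1) * q)
  u-plus-complement k n e e≤q =
    trans (cong (_+ (q ∸ e)) (u-unfold q k n e))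
          (u-plus-complement-identity q e (q ∸ e) (q ^ n ∸ 1) (q ^ k ∸ 1) (q ^ n)
             (m+[n∸m]≡n e≤q) (m∸n+n≡m (m^n>0 q n)))

  -- The number whose base-q digits are, from the units digit up, the blocks
  -- d² | 2(q-1)d | W | 0 | q-2 | 2 | K₂ of lengths n+1, k+1, o+2, 1, k, 1, k,
  -- where n = k + 2 + o.
  square-layout : (k o d W K₂ : ℕ) → ℕ
  square-layout k o d W K₂ =
    d * d + q ^ suc (k + 2 + o) * (2 * suc b * d + q ^ suc k * (W + q ^ (2 + o) * (q * (b + q ^ k * (2 + q * K₂)))))

  u²-layout : ∀ k o e W K₂ → e ≤ q → 2 + K₂ ≡ q ^ k → 2 * (q ∸ e) + W ≡ q ^ (2 + o) →
    let n = k + 2 + o in u q k n e * u q k n e ≡ square-layout k o (q ∸ e) W K₂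
  u²-layout k o e W K₂ e≤q 2+K₂ 2d+W =
    square-from-sum (u q k n e) (q ∸ e) (q ^ suc n * (1 + (q ^ k ∸ 1) * q)) (square-layout k o (q ∸ e) W K₂)
      (u-plus-complement k n e e≤q)
      (square-identity b (q ∸ e) K₂ W (q ^ k) (q ^ (2 + o)) (q ^ suc n) 2+K₂ 2d+W power-split)
    where
    n = k + 2 + o
    power-split : q * q ^ k * q ^ (2 + o) ≡ q ^ suc n
    power-split = trans (*-assoc q (q ^ k) (q ^ (2 + o)))
      (cong (q *_) (trans (sym (^-distribˡ-+-* q k (2 + o))) (cong (q ^_) (sym (+-assoc k 2 o)))))

  square-fits : ∀ n d → 2 ≤ n → d ≤ q → d * d < q ^ suc n
  square-fits n d 2≤n d≤q = begin-strict
    d * d      ≤⟨ *-mono-≤ d≤q d≤q ⟩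
    q * q      ≤⟨ pow-square n 2≤n ⟩
    q ^ n      <⟨ ^-monoʳ-< q (s≤s (s≤s z≤n)) (n<1+n n) ⟩
    q ^ suc n  ∎
    where open ≤-Reasoning

  carry-fits : ∀ k d → 2 ≤ k → d ≤ q → 2 * suc b * d < q ^ suc k
  carry-fits k d 2≤k d≤q = begin-strict
    2 * suc b * d   ≤⟨ *-monoʳ-≤ (2 * suc b) d≤q ⟩
    2 * suc b * q   <⟨ *-monoˡ-< q 2[q-1]<q² ⟩
    q * q * q       ≡⟨ *-comm (q * q) q ⟩
    q * (q * q)     ≤⟨ *-monoʳ-≤ q (pow-square k 2≤k) ⟩
    q ^ suc k       ∎
    where
    open ≤-Reasoning
    2[q-1]<q² : 2 * suc b < q * q
    2[q-1]<q² = <-≤-trans (*-monoʳ-< 2 {suc b} {q} ≤-refl) 2q≤q²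

  s-square-layout : ∀ k o d W K₂ → 2 < q → 2 ≤ k → d ≤ q → W < q ^ (2 + o) →
    s q (square-layout k o d W K₂) ≡ s q (d * d) + (s q (2 * suc b * d) + (s q W + (b + (2 + s q K₂))))
  s-square-layout k o d W K₂ 2<q 2≤k d≤q W<M = begin
    s q (square-layout k o d W K₂)
      ≡⟨ s-concat (suc n) (d * d) _ (square-fits n d 2≤n d≤q) ⟩
    s q (d * d) + s q (2 * suc b * d + q ^ suc k * (W + q ^ (2 + o) * (q * X)))
      ≡⟨ cong (s q (d * d) +_) (s-concat (suc k) (2 * suc b * d) _ (carry-fits k d 2≤k d≤q)) ⟩
    s q (d * d) + (s q (2 * suc b * d) + s q (W + q ^ (2 + o) * (q * X)))
      ≡⟨ cong (λ x → s q (d * d) + (s q (2 * suc b * d) + x)) (s-concat (2 + o) W (q * X) W<M) ⟩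
    s q (d * d) + (s q (2 * suc b * d) + (s q W + s q (q * X)))
      ≡⟨ cong (λ x → s q (d * d) + (s q (2 * suc b * d) + (s q W + x))) (trans (s-shift X) s-X) ⟩
    s q (d * d) + (s q (2 * suc b * d) + (s q W + (b + (2 + s q K₂))))
      ∎
    where
    open ≡-Reasoning
    n = k + 2 + o
    X = b + q ^ k * (2 + q * K₂)
    b<q : b < q
    b<q = s≤s (n≤1+n b)
    2≤n : 2 ≤ n
    2≤n = ≤-trans (m≤n+m 2 k) (m≤m+n (k + 2) o)
    s-X : s q X ≡ b + (2 + s q K₂)
    s-X = begin
      s q X                          ≡⟨ s-concat k b (2 + q * K₂) (<-≤-trans b<q (≤-trans (m≤m*n q q) (pow-square k 2≤k))) ⟩
      s q b + s q (2 + q * K₂)       ≡⟨ cong₂ _+_ (s-small b b<q) (s-digit 2 K₂ 2<q) ⟩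
      b + (2 + s q K₂)               ∎

  s-u² : ∀ k n e → 2 < q → 2 ≤ k → k + 2 ≤ n → e < q →
    s q (u q k n e * u q k n e) + fMinus q e ≡ (q ∸ 1) * (n + 1) + fPlus q e
  s-u² k n e 2<q 2≤k k+2≤n e<q with m≤n⇒∃[o]m+o≡n k+2≤n
  ... | o , refl = begin
    s q (u q k n e * u q k n e) + s q c
      ≡⟨ cong (λ x → s q x + s q c) (u²-layout k o e W K₂ (<⇒≤ e<q) 2+K₂ 2d+W) ⟩
    s q (square-layout k o d W K₂) + s q c
      ≡⟨ cong (_+ s q c) (s-square-layout k o d W K₂ 2<q 2≤k (m∸n≤m q e) (complement-boundʳ 1+c+W)) ⟩
    s q (d * d) + (s q (2 * suc b * d) + (s q W + (b + (2 + s q K₂)))) + s q c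
      ≡⟨ digit-count b k o (s q (d * d)) (s q (2 * suc b * d)) (s q W) (s q K₂) (s q c)
           (s-complement (2 + o) c W 1+c+W) (s-complement k 1 K₂ 2+K₂) ⟩
    suc b * (n + 1) + (s q (d * d) + s q (2 * suc b * d))
      ∎
    where
    open ≡-Reasoning
    d = q ∸ e
    M = q ^ (2 + o)
    W = M ∸ 2 * d
    K₂ = q ^ k ∸ 2
    c = 2 * d ∸ 1
    2d≤M : 2 * d ≤ M
    2d≤M = ≤-trans (*-monoʳ-≤ 2 (m∸n≤m q e)) (≤-trans 2q≤q² (pow-square (2 + o) (s≤s (s≤s z≤n))))
    2d+W : 2 * d + W ≡ M
    2d+W = m+[n∸m]≡n 2d≤M
    2+K₂ : 2 + K₂ ≡ q ^ k
    2+K₂ = m+[n∸m]≡n (≤-trans (m≤m*n 2 q) (≤-trans 2q≤q² (pow-square k 2≤k)))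
    1+c+W : suc c + W ≡ M
    1+c+W = trans (cong (_+ W) (m+[n∸m]≡n (≤-trans (m<n⇒0<n∸m e<q) (m≤m+n d (d + 0))))) 2d+W

lemma6p1 : (q k n e : ℕ) → 3 ≤ q → 2 ≤ k → k + 2 ≤ n → e ≤ q ∸ 2 →
    let u = e + (q ^ n ∸ 1) * q + (q ^ k ∸ 1) * q ^ (n + 2) in
    (s q u ≡ (q ∸ 1) * (n + k) + e) ×
    (s q (u * u) + fMinus q e ≡ (q ∸ 1) * (n + 1) + fPlus q e)
lemma6p1 (suc zero) k n e (s≤s ())
lemma6p1 (suc (suc b)) k n e 3≤q 2≤k k+2≤n e≤b = s-u k n e e<q , s-u² k n e 3≤q 2≤k k+2≤n e<q
  where
  open Digits b
  e<q : e < q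
  e<q = s≤s (m≤n⇒m≤1+n e≤b)
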